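{- Fix an integer $c\geq 2$, a positive integer $n$, and positive integers $e_1,\dots,e_n$. Let $u=I_{c}^{e_{1}}D_{c}^{e_{2}}I_{c}^{e_{3}}\ldots \mathcal{L}_{c}^{e_{n}}$, where $\mathcal{L}$ is $I$ if $n$ is odd and $D$ if $n$ is even. Define $A= \sum_{i\geq 1}e_{2i-1}$, $B = \sum_{i\geq 1}e_{2i}$, $M= \max(A, B)$, $m= \min(A, B)$. Then $\mathit{l}(u)=(c-1)m+M+ \lfloor n/2\rfloor$.
   Context: A sequence $s$ contains a sequence $u$ if some subsequence of $s$ can be changed into $u$ by a one-to-one renaming of its letters. $I_c$ denotes the sequence $1\,2\ldots c$ and $D_c$ the sequence $c\,(c-1)\ldots 1$; powers denote repeated concatenation. $\mathit{up}(c,k)$ is $I_c$ repeated $k$ times. For a sequence $u$ with $c$ distinct letters, $\mathit{l}(u)$ is the smallest $k$ such that $\mathit{up}(c,k)$ contains $u$. -}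

module Defs where

open import Data.Bool using (Bool; true; false; not)
open import Data.Nat using (ℕ; zero; suc; _+_; _≤_; _∸_)
open import Data.List using (List; []; _∷_; _++_; map; concat; replicate; upTo; reverse)
open import Data.List.Membership.Propositional using (_∈_)
open import Data.List.Relation.Binary.Sublist.Propositional using (_⊆_)
open import Data.Vec using (Vec; []; _∷_)
open import Data.Product using (Σ; ∃; _×_)
open import Relation.Binary.PropositionalEquality using (_≡_)

I : ℕ → List ℕ
I c = map suc (upTo c)

D : ℕ → List ℕ
D c = reverse (I c)

_^^_ : List ℕ → ℕ → List ℕ
w ^^ k = concat (replicate k w)

up : ℕ → ℕ → List ℕ
up c k = I c ^^ k

InjectiveOn : (ℕ → ℕ) → List ℕ → Set
InjectiveOn f w = ∀ {x y} → x ∈ w → y ∈ w → f x ≡ f y → x ≡ y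

Contains : List ℕ → List ℕ → Set
Contains s u = Σ (List ℕ) λ t → (t ⊆ s) × (Σ (ℕ → ℕ) λ f → InjectiveOn f t × (map f t ≡ u))

IsL : ℕ → List ℕ → ℕ → Set
IsL c u k = Contains (up c k) u × (∀ j → Contains (up c j) u → k ≤ j)

altWord : ℕ → Bool → ∀ {n} → Vec ℕ n → List ℕ
altWord c b [] = []
altWord c true  (e ∷ es) = (I c ^^ e) ++ altWord c false es
altWord c false (e ∷ es) = (D c ^^ e) ++ altWord c true es

uWord : ℕ → ∀ {n} → Vec ℕ n → List ℕ
uWord c es = altWord c true es

-- sum of entries at odd positions (1-indexed) when flag = true
altSum : Bool → ∀ {n} → Vec ℕ n → ℕ
altSum b [] = 0
altSum true  (e ∷ es) = e + altSum false es
altSum false (e ∷ es) = altSum true es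

sumOdd : ∀ {n} → Vec ℕ n → ℕ
sumOdd es = altSum true es

sumEven : ∀ {n} → Vec ℕ n → ℕ
sumEven es = altSum false es

module Submission where

-- A sequence t over 1 … c lies in up(c, k) exactly when k is at least the number of non-ascents
-- of t, its first letter counting as one: greedily, each copy of I_c takes a strictly increasing
-- stretch of t. Hence l(u) is the least number of non-ascents of h(u) over renamings h injective
-- on 1 … c. For u this number is
--   ⌈n/2⌉ y + ⌊n/2⌋ x + A (x + dI) + B (y + dD),
-- where dI and dD count the non-ascents inside h(I_c) and h(D_c), and the seams x = [h 1 ≤ h c],
-- y = [h c ≤ h 1] are paid between repeated copies of I_c, resp. D_c. Injectivity forces x + y = 1
-- and dI + dD = c - 1, while dI = 0 forces x = 1 and dD = 0 forces y = 1. Minimising under these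
-- constraints gives the formula; it is attained by the identity when B ≤ A, and by the renaming
-- that reverses 1 … c - 1 and fixes c when A ≤ B.

open import Defs
open import Data.Nat using (ℕ; _+_; _*_; _∸_; _≤_; _<_; _⊔_; _⊓_; _/_)
open import Data.Vec using (Vec)
open import Data.Vec.Relation.Unary.All using (All)

open import Data.Bool using (Bool; true; false; not)
open import Data.Empty using (⊥-elim)
open import Data.List using (List; []; _∷_; _++_; map; reverse; applyUpTo; drop; [_])
open import Data.List.Membership.Propositional using (_∈_)
open import Data.List.Membership.Propositional.Properties using (∈-map⁺; ∈-map⁻; ∈-++⁺ˡ; ∈-upTo⁺; ∈-upTo⁻)
open import Data.List.Properties using (++-assoc; reverse-++; map-upTo; map-∘; map-id-local)
open import Data.List.Relation.Binary.Sublist.Propositional using (_⊆_; []; _∷_; _∷ʳ_; minimum; ⊆-refl; ⊆-trans)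
open import Data.List.Relation.Binary.Sublist.Propositional.Properties using (++⁺ˡ)
open import Data.List.Relation.Unary.Any using (here; there)
open import Data.List.Relation.Unary.Any.Properties using (reverse⁻)
import Data.List.Relation.Unary.All as ListAll
open import Data.List.Relation.Unary.All.Properties using (++⁺; concat⁺; replicate⁺; map⁺)
open import Data.Nat using (zero; suc; z≤n; s≤s; _≤?_; _≟_)
open import Data.Nat.DivMod using (m/n≡1+[m∸n]/n)
open import Data.Nat.Properties
open import Data.Nat.Tactic.RingSolver using (solve-∀)
open import Data.Product using (Σ; _×_; _,_; proj₁; proj₂)
open import Data.Sum using (inj₁; inj₂)
open import Data.Vec using ([]; _∷_)
open import Data.Vec.Relation.Unary.All using (_∷_)
open import Function using (id; _∘_)
open import Relation.Binary.PropositionalEquality using (_≡_; _≢_; refl; sym; trans; cong; cong₂; subst; subst₂; module ≡-Reasoning)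
open import Relation.Nullary using (¬_; yes; no)

Letter : ℕ → ℕ → Set
Letter c a = 1 ≤ a × a ≤ c

interval : ℕ → ℕ → List ℕ
interval s zero = []
interval s (suc k) = s ∷ interval (suc s) k

countdown : ℕ → List ℕ
countdown zero = []
countdown (suc k) = suc k ∷ countdown k

interval-++ : ∀ s i j → interval s (i + suc j) ≡ interval s i ++ (s + i) ∷ interval (suc (s + i)) j
interval-++ s zero j rewrite +-identityʳ s = refl
interval-++ s (suc i) j rewrite +-suc s i = cong (s ∷_) (interval-++ (suc s) i j)

interval-∷ʳ : ∀ s k → interval s (suc k) ≡ interval s k ++ [ s + k ]
interval-∷ʳ s k = trans (cong (interval s) (+-comm 1 k)) (interval-++ s k 0)

applyUpTo-interval : ∀ (f : ℕ → ℕ) s k → (∀ i → f i ≡ s + i) → applyUpTo f k ≡ interval s k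
applyUpTo-interval f s zero f≗ = refl
applyUpTo-interval f s (suc k) f≗ =
  cong₂ _∷_ (trans (f≗ 0) (+-identityʳ s))
    (applyUpTo-interval (f ∘ suc) (suc s) k (λ i → trans (f≗ (suc i)) (+-suc s i)))

I≡interval : ∀ c → I c ≡ interval 1 c
I≡interval c = trans (map-upTo suc c) (applyUpTo-interval suc 1 c (λ _ → refl))

reverse-interval : ∀ k → reverse (interval 1 k) ≡ countdown k
reverse-interval zero = refl
reverse-interval (suc k) = begin
  reverse (interval 1 (suc k))           ≡⟨ cong reverse (interval-∷ʳ 1 k) ⟩
  reverse (interval 1 k ++ [ suc k ])    ≡⟨ reverse-++ (interval 1 k) [ suc k ] ⟩
  suc k ∷ reverse (interval 1 k)         ≡⟨ cong (suc k ∷_) (reverse-interval k) ⟩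
  countdown (suc k)                      ∎
  where open ≡-Reasoning

D≡countdown : ∀ c → D c ≡ countdown c
D≡countdown c = trans (cong reverse (I≡interval c)) (reverse-interval c)

up≡interval^^ : ∀ c k → up c k ≡ interval 1 c ^^ k
up≡interval^^ c k = cong (_^^ k) (I≡interval c)

lastOf : ℕ → List ℕ → ℕ
lastOf q [] = q
lastOf q (y ∷ w) = lastOf y w

lastOf-++ : ∀ q xs ys → lastOf q (xs ++ ys) ≡ lastOf (lastOf q xs) ys
lastOf-++ q [] ys = refl
lastOf-++ q (x ∷ xs) ys = lastOf-++ x xs ys

lastOf-interval : ∀ s k → lastOf s (interval (suc s) k) ≡ s + k
lastOf-interval s zero = sym (+-identityʳ s)
lastOf-interval s (suc k) = trans (lastOf-interval (suc s) k) (sym (+-suc s k))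

lastOf-countdown : ∀ k → lastOf (suc k) (countdown k) ≡ 1
lastOf-countdown zero = refl
lastOf-countdown (suc k) = lastOf-countdown k

⟦_≤_⟧ : ℕ → ℕ → ℕ
⟦ x ≤ y ⟧ with x ≤? y
... | yes _ = 1
... | no _ = 0

⟦≤⟧≡1 : ∀ {x y} → x ≤ y → ⟦ x ≤ y ⟧ ≡ 1
⟦≤⟧≡1 {x} {y} x≤y with x ≤? y
... | yes _ = refl
... | no x≰y = ⊥-elim (x≰y x≤y)

⟦≤⟧≡0 : ∀ {x y} → ¬ x ≤ y → ⟦ x ≤ y ⟧ ≡ 0
⟦≤⟧≡0 {x} {y} x≰y with x ≤? y
... | yes x≤y = ⊥-elim (x≰y x≤y)
... | no _ = refl

⟦≤⟧≡0⇒> : ∀ {x y} → ⟦ x ≤ y ⟧ ≡ 0 → y < x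
⟦≤⟧≡0⇒> {x} {y} eq with x ≤? y
... | no x≰y = ≰⇒> x≰y

⟦≤⟧≤1 : ∀ x y → ⟦ x ≤ y ⟧ ≤ 1
⟦≤⟧≤1 x y with x ≤? y
... | yes _ = ≤-refl
... | no _ = z≤n

⟦≤⟧-monoʳ : ∀ x y → ⟦ x ≤ y ⟧ ≤ ⟦ x ≤ suc y ⟧
⟦≤⟧-monoʳ x y with x ≤? y
... | yes x≤y = ≤-reflexive (sym (⟦≤⟧≡1 (m≤n⇒m≤1+n x≤y)))
... | no _ = z≤n

⟦≤⟧+⟦≥⟧≡1 : ∀ {x y} → x ≢ y → ⟦ x ≤ y ⟧ + ⟦ y ≤ x ⟧ ≡ 1
⟦≤⟧+⟦≥⟧≡1 {x} {y} x≢y with x ≤? y | y ≤? x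
... | yes x≤y | yes y≤x = ⊥-elim (x≢y (≤-antisym x≤y y≤x))
... | yes _   | no _    = refl
... | no _    | yes _   = refl
... | no x≰y  | no y≰x  = ⊥-elim (x≰y (≰⇒≥ y≰x))

-- The letter q plays the role of the letter preceding w.
nonAscents : (ℕ → ℕ) → ℕ → List ℕ → ℕ
nonAscents h q [] = 0
nonAscents h q (y ∷ w) = ⟦ h y ≤ h q ⟧ + nonAscents h y w

nonAscents-++ : ∀ h q xs ys → nonAscents h q (xs ++ ys) ≡ nonAscents h q xs + nonAscents h (lastOf q xs) ys
nonAscents-++ h q [] ys = refl
nonAscents-++ h q (x ∷ xs) ys =
  trans (cong (⟦ h x ≤ h q ⟧ +_) (nonAscents-++ h x xs ys)) (sym (+-assoc ⟦ h x ≤ h q ⟧ _ _))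

nonAscents-map : ∀ h q w → nonAscents id (h q) (map h w) ≡ nonAscents h q w
nonAscents-map h q [] = refl
nonAscents-map h q (y ∷ w) = cong (⟦ h y ≤ h q ⟧ +_) (nonAscents-map h y w)

nonAscents-map-∷ : ∀ h {q} y w → h y ≤ q → nonAscents id q (map h (y ∷ w)) ≡ nonAscents h y (y ∷ w)
nonAscents-map-∷ h y w hy≤q =
  cong₂ _+_ (trans (⟦≤⟧≡1 hy≤q) (sym (⟦≤⟧≡1 ≤-refl))) (nonAscents-map h y w)

nonAscents≡0⇒≤lastOf : ∀ h q w → nonAscents h q w ≡ 0 → h q ≤ h (lastOf q w)
nonAscents≡0⇒≤lastOf h q [] _ = ≤-refl
nonAscents≡0⇒≤lastOf h q (y ∷ w) eq =
  ≤-trans (<⇒≤ (⟦≤⟧≡0⇒> (m+n≡0⇒m≡0 _ eq))) (nonAscents≡0⇒≤lastOf h y w (m+n≡0⇒n≡0 _ eq))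

nonAscents-interval≡0 : ∀ s k → nonAscents id s (interval (suc s) k) ≡ 0
nonAscents-interval≡0 s zero = refl
nonAscents-interval≡0 s (suc k) =
  cong₂ _+_ (⟦≤⟧≡0 (n≮n s)) (nonAscents-interval≡0 (suc s) k)

module _ (h : ℕ → ℕ) {a z : ℕ} (W : List ℕ) (ends : lastOf a W ≡ z) where

  private
    seam inner : ℕ
    seam = ⟦ h a ≤ h z ⟧
    inner = nonAscents h a W

  nonAscents-^^ : ∀ k R → nonAscents h z (((a ∷ W) ^^ k) ++ R) ≡ k * (seam + inner) + nonAscents h z R
  nonAscents-^^ zero R = refl
  nonAscents-^^ (suc k) R = begin
    seam + nonAscents h a ((W ++ P) ++ R)                 ≡⟨ cong (λ w → seam + nonAscents h a w) (++-assoc W P R) ⟩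
    seam + nonAscents h a (W ++ P ++ R)                   ≡⟨ cong (seam +_) (nonAscents-++ h a W (P ++ R)) ⟩
    seam + (inner + nonAscents h (lastOf a W) (P ++ R))   ≡⟨ cong (λ q → seam + (inner + nonAscents h q (P ++ R))) ends ⟩
    seam + (inner + nonAscents h z (P ++ R))              ≡⟨ cong (λ m → seam + (inner + m)) (nonAscents-^^ k R) ⟩
    seam + (inner + (k * (seam + inner) + nonAscents h z R))
      ≡⟨ regroup seam inner k (nonAscents h z R) ⟩
    suc k * (seam + inner) + nonAscents h z R             ∎
    where
    open ≡-Reasoning
    P = (a ∷ W) ^^ k
    regroup : ∀ x i k r → x + (i + (k * (x + i) + r)) ≡ suc k * (x + i) + r
    regroup = solve-∀

  -- Entering the block from its own first letter costs 1 instead of the seam.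
  nonAscents-block : ∀ k R {y} → seam + y ≡ 1 →
    nonAscents h a (((a ∷ W) ^^ suc k) ++ R) ≡ y + suc k * (seam + inner) + nonAscents h z R
  nonAscents-block k R {y} seam+y≡1 = begin
    ⟦ h a ≤ h a ⟧ + rest                          ≡⟨ cong (_+ rest) (trans (⟦≤⟧≡1 ≤-refl) (sym seam+y≡1)) ⟩
    seam + y + rest                               ≡⟨ regroup seam y rest ⟩
    y + (seam + rest)                             ≡⟨ cong (y +_) (nonAscents-^^ (suc k) R) ⟩
    y + (suc k * (seam + inner) + nonAscents h z R) ≡⟨ sym (+-assoc y _ _) ⟩
    y + suc k * (seam + inner) + nonAscents h z R   ∎
    where
    open ≡-Reasoning
    rest = nonAscents h a ((W ++ (a ∷ W) ^^ k) ++ R)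
    regroup : ∀ x y r → x + y + r ≡ y + (x + r)
    regroup = solve-∀

nonAscents-monoˡ : ∀ p t → nonAscents id p t ≤ nonAscents id (suc p) t
nonAscents-monoˡ p [] = z≤n
nonAscents-monoˡ p (y ∷ t) = +-monoˡ-≤ (nonAscents id y t) (⟦≤⟧-monoʳ y p)

nonAscents≤1+nonAscents-0 : ∀ p t → nonAscents id p t ≤ suc (nonAscents id 0 t)
nonAscents≤1+nonAscents-0 p [] = z≤n
nonAscents≤1+nonAscents-0 p (y ∷ t) = +-mono-≤ (⟦≤⟧≤1 y p) (m≤n+m (nonAscents id y t) ⟦ y ≤ 0 ⟧)

-- A non-ascent of t can only happen by moving on to a later copy of I c.
⊆-intervals⇒nonAscents≤ : ∀ c k r p t → t ⊆ interval (suc p) r ++ interval 1 c ^^ k → nonAscents id p t ≤ k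
⊆-intervals⇒nonAscents≤ c k (suc r) p t (_ ∷ʳ t⊆) =
  ≤-trans (nonAscents-monoˡ p t) (⊆-intervals⇒nonAscents≤ c k r (suc p) t t⊆)
⊆-intervals⇒nonAscents≤ c k (suc r) p (_ ∷ t) (refl ∷ t⊆) =
  subst (_≤ k) (cong (_+ nonAscents id (suc p) t) (sym (⟦≤⟧≡0 (n≮n p)))) (⊆-intervals⇒nonAscents≤ c k r (suc p) t t⊆)
⊆-intervals⇒nonAscents≤ c zero zero p [] [] = z≤n
⊆-intervals⇒nonAscents≤ c (suc k) zero p t t⊆ =
  ≤-trans (nonAscents≤1+nonAscents-0 p t) (s≤s (⊆-intervals⇒nonAscents≤ c k c 0 t t⊆))

∷-⊆-interval : ∀ {s r y j w X} → s ≤ y → y + suc j ≡ s + r →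
  w ⊆ interval (suc y) j ++ X → (y ∷ w) ⊆ interval s r ++ X
∷-⊆-interval {s} {r} {y} {j} {w} {X} s≤y y+1+j≡s+r w⊆ with m≤n⇒∃[o]m+o≡n s≤y
... | i , refl = subst (λ r → (y ∷ w) ⊆ interval s r ++ X) (sym r≡i+1+j) y∷w⊆
  where
  r≡i+1+j : r ≡ i + suc j
  r≡i+1+j = +-cancelˡ-≡ s r (i + suc j) (trans (sym y+1+j≡s+r) (+-assoc s i (suc j)))
  y∷w⊆ : (y ∷ w) ⊆ interval s (i + suc j) ++ X
  y∷w⊆ = subst (λ L → (y ∷ w) ⊆ L)
           (sym (trans (cong (_++ X) (interval-++ s i j)) (++-assoc (interval s i) _ X)))
           (++⁺ˡ (interval s i) (refl ∷ w⊆))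

-- Greedy embedding: each letter is taken from the current copy of I c if it is still ahead,
-- otherwise from the next copy.
⊆-intervals-nonAscents : ∀ c p r w → p + r ≡ c → ListAll.All (Letter c) w →
  w ⊆ interval (suc p) r ++ interval 1 c ^^ nonAscents id p w
⊆-intervals-nonAscents c p r [] _ _ = minimum _
⊆-intervals-nonAscents c p r (y ∷ w) p+r≡c ((1≤y , y≤c) ListAll.∷ letters) with m≤n⇒∃[o]m+o≡n y≤c
... | j , y+j≡c with y ≤? p
...   | yes y≤p = ++⁺ˡ (interval (suc p) r) (∷-⊆-interval 1≤y (trans (+-suc y j) (cong suc y+j≡c)) rest)
  where rest = ⊆-intervals-nonAscents c y j w y+j≡c letters
...   | no y≰p = ∷-⊆-interval (≰⇒> y≰p) (trans (+-suc y j) (cong suc (trans y+j≡c (sym p+r≡c)))) rest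
  where rest = ⊆-intervals-nonAscents c y j w y+j≡c letters

⊆-up⇒nonAscents≤ : ∀ c k p t → t ⊆ up c k → nonAscents id p t ≤ k
⊆-up⇒nonAscents≤ c k p t t⊆ = ⊆-intervals⇒nonAscents≤ c k 0 p t (subst (t ⊆_) (up≡interval^^ c k) t⊆)

⊆-up-nonAscents : ∀ c w → ListAll.All (Letter c) w → w ⊆ up c (nonAscents id c w)
⊆-up-nonAscents c w letters =
  subst (w ⊆_) (sym (up≡interval^^ c (nonAscents id c w))) (⊆-intervals-nonAscents c c 0 w (+-identityʳ c) letters)

preimage : (ℕ → ℕ) → List ℕ → ℕ → ℕ
preimage f [] a = 0
preimage f (x ∷ xs) a with f x ≟ a
... | yes _ = x
... | no _ = preimage f xs a

preimage-∈ : ∀ f xs {x} → x ∈ xs → preimage f xs (f x) ∈ xs × f (preimage f xs (f x)) ≡ f x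
preimage-∈ f (y ∷ ys) {x} x∈ with f y ≟ f x
... | yes fy≡fx = here refl , fy≡fx
preimage-∈ f (y ∷ ys) (here refl) | no fy≢fy = ⊥-elim (fy≢fy refl)
preimage-∈ f (y ∷ ys) (there x∈) | no _ = let (p∈ , eq) = preimage-∈ f ys x∈ in there p∈ , eq

contains⇒injective-renaming : ∀ {s u} → Contains s u → Σ (ℕ → ℕ) λ h → InjectiveOn h u × map h u ⊆ s
contains⇒injective-renaming {s} {u} (t , t⊆s , f , f-inj , map-f-t≡u) = h , h-inj , subst (_⊆ s) (sym map-h-u≡t) t⊆s
  where
  h = preimage f t
  h-f : ∀ {x} → x ∈ t → h (f x) ≡ x
  h-f x∈ = let (p∈ , eq) = preimage-∈ f t x∈ in f-inj p∈ x∈ eq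
  f-h : ∀ {a} → a ∈ u → f (h a) ≡ a
  f-h a∈ with ∈-map⁻ f (subst (_ ∈_) (sym map-f-t≡u) a∈)
  ... | x , x∈ , refl = proj₂ (preimage-∈ f t x∈)
  h-inj : InjectiveOn h u
  h-inj a∈ b∈ ha≡hb = trans (sym (f-h a∈)) (trans (cong f ha≡hb) (f-h b∈))
  map-h-u≡t : map h u ≡ t
  map-h-u≡t = begin
    map h u             ≡⟨ cong (map h) (sym map-f-t≡u) ⟩
    map h (map f t)     ≡⟨ sym (map-∘ t) ⟩
    map (h ∘ f) t       ≡⟨ map-id-local (ListAll.tabulate h-f) ⟩
    t                   ∎
    where open ≡-Reasoning

involution⇒contains : ∀ {s u} (g : ℕ → ℕ) → (∀ {a} → a ∈ u → g (g a) ≡ a) → map g u ⊆ s → Contains s u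
involution⇒contains {s} {u} g g∘g≡id map-g-u⊆s = map g u , map-g-u⊆s , g , g-inj , map-g-map-g
  where
  g-inj : InjectiveOn g (map g u)
  g-inj x∈ y∈ gx≡gy with ∈-map⁻ g x∈ | ∈-map⁻ g y∈
  ... | a , a∈ , refl | b , b∈ , refl = cong g (trans (sym (g∘g≡id a∈)) (trans gx≡gy (g∘g≡id b∈)))
  map-g-map-g : map g (map g u) ≡ u
  map-g-map-g = trans (sym (map-∘ u)) (map-id-local (ListAll.tabulate g∘g≡id))

up-⊆ : ∀ c a d → up c a ⊆ up c (d + a)
up-⊆ c a zero = ⊆-refl
up-⊆ c a (suc d) = ++⁺ˡ (I c) (up-⊆ c a d)

contains-up-mono : ∀ {c a b u} → a ≤ b → Contains (up c a) u → Contains (up c b) u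
contains-up-mono {c} {a} a≤b (t , t⊆ , rename) with m≤n⇒∃[o]m+o≡n a≤b
... | d , refl = t , ⊆-trans t⊆ (subst (λ k → up c a ⊆ up c k) (+-comm d a) (up-⊆ c a d)) , rename

altCount : Bool → ∀ {n} → Vec ℕ n → ℕ
altCount b [] = 0
altCount true (e ∷ es) = suc (altCount false es)
altCount false (e ∷ es) = altCount true es

altCount≡half : ∀ {n} (es : Vec ℕ n) → altCount false es ≡ n / 2 × altCount true es ≡ suc n / 2
altCount≡half [] = refl , refl
altCount≡half {suc n} (e ∷ es) with altCount≡half es
... | false≡ , true≡ = true≡ , trans (cong suc false≡) (sym (m/n≡1+[m∸n]/n {suc (suc n)} {2} (s≤s (s≤s z≤n))))

altCount-false≤true : ∀ {n} (es : Vec ℕ n) → altCount false es ≤ altCount true es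
altCount-false≤true [] = z≤n
altCount-false≤true (e ∷ []) = z≤n
altCount-false≤true (e ∷ d ∷ es) = s≤s (altCount-false≤true es)

blockSum : (cT cF A B dI dD x y : ℕ) → ℕ
blockSum cT cF A B dI dD x y = cT * y + cF * x + A * (x + dI) + B * (y + dD)

module BlockStatistics (c' : ℕ) (h : ℕ → ℕ) where

  insideI insideD seamI seamD : ℕ
  insideI = nonAscents h 1 (interval 2 c')
  insideD = nonAscents h (suc c') (countdown c')
  seamI = ⟦ h 1 ≤ h (suc c') ⟧
  seamD = ⟦ h (suc c') ≤ h 1 ⟧

  precedingLetter : Bool → ℕ
  precedingLetter true = 1
  precedingLetter false = suc c'

  nonAscents-altWord : seamI + seamD ≡ 1 → ∀ b {n} (es : Vec ℕ n) → All (λ x → 1 ≤ x) es →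
    nonAscents h (precedingLetter b) (altWord (suc c') b es)
      ≡ blockSum (altCount b es) (altCount (not b) es) (altSum b es) (altSum (not b) es) insideI insideD seamI seamD
  nonAscents-altWord seams b [] _ = refl
  nonAscents-altWord seams true (suc e ∷ es) (_ ∷ positive) = begin
    nonAscents h 1 ((I (suc c') ^^ suc e) ++ rest)
      ≡⟨ cong (λ W → nonAscents h 1 ((W ^^ suc e) ++ rest)) (I≡interval (suc c')) ⟩
    nonAscents h 1 (((1 ∷ interval 2 c') ^^ suc e) ++ rest)
      ≡⟨ nonAscents-block h (interval 2 c') (lastOf-interval 1 c') e rest seams ⟩
    seamD + suc e * (seamI + insideI) + nonAscents h (suc c') rest
      ≡⟨ cong (seamD + suc e * (seamI + insideI) +_) (nonAscents-altWord seams false es positive) ⟩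
    _ ≡⟨ regroup seamI seamD insideI insideD e (altCount false es) (altCount true es) (altSum false es) (altSum true es) ⟩
    _ ∎
    where
    open ≡-Reasoning
    rest = altWord (suc c') false es
    regroup : ∀ x y dI dD e cF cT AF AT →
      y + suc e * (x + dI) + (cF * y + cT * x + AF * (x + dI) + AT * (y + dD))
        ≡ suc cF * y + cT * x + (suc e + AF) * (x + dI) + AT * (y + dD)
    regroup = solve-∀
  nonAscents-altWord seams false (suc e ∷ es) (_ ∷ positive) = begin
    nonAscents h (suc c') ((D (suc c') ^^ suc e) ++ rest)
      ≡⟨ cong (λ W → nonAscents h (suc c') ((W ^^ suc e) ++ rest)) (D≡countdown (suc c')) ⟩
    nonAscents h (suc c') (((suc c' ∷ countdown c') ^^ suc e) ++ rest)
      ≡⟨ nonAscents-block h (countdown c') (lastOf-countdown c') e rest (trans (+-comm seamD seamI) seams) ⟩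
    seamI + suc e * (seamD + insideD) + nonAscents h 1 rest
      ≡⟨ cong (seamI + suc e * (seamD + insideD) +_) (nonAscents-altWord seams true es positive) ⟩
    _ ≡⟨ regroup seamI seamD insideI insideD e (altCount false es) (altCount true es) (altSum false es) (altSum true es) ⟩
    _ ∎
    where
    open ≡-Reasoning
    rest = altWord (suc c') true es
    regroup : ∀ x y dI dD e cF cT AF AT →
      x + suc e * (y + dD) + (cT * y + cF * x + AT * (x + dI) + AF * (y + dD))
        ≡ cT * y + suc cF * x + AT * (x + dI) + (suc e + AF) * (y + dD)
    regroup = solve-∀

  seamI+seamD≡1 : h 1 ≢ h (suc c') → seamI + seamD ≡ 1
  seamI+seamD≡1 = ⟦≤⟧+⟦≥⟧≡1

  insideI≡0⇒seamI≡1 : insideI ≡ 0 → seamI ≡ 1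
  insideI≡0⇒seamI≡1 inside≡0 =
    ⟦≤⟧≡1 (subst (λ z → h 1 ≤ h z) (lastOf-interval 1 c') (nonAscents≡0⇒≤lastOf h 1 (interval 2 c') inside≡0))

  insideD≡0⇒seamD≡1 : insideD ≡ 0 → seamD ≡ 1
  insideD≡0⇒seamD≡1 inside≡0 =
    ⟦≤⟧≡1 (subst (λ z → h (suc c') ≤ h z) (lastOf-countdown c') (nonAscents≡0⇒≤lastOf h (suc c') (countdown c') inside≡0))

  -- Between consecutive letters a, a + 1 exactly one of I and D has a non-ascent.
  insideI+insideD≡c' : (∀ a → a < c' → h (suc a) ≢ h (suc (suc a))) → insideI + insideD ≡ c'
  insideI+insideD≡c' adjacent-distinct = go c' ≤-refl
    where
    go : ∀ k → k ≤ c' → nonAscents h 1 (interval 2 k) + nonAscents h (suc k) (countdown k) ≡ k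
    go zero _ = refl
    go (suc k) k<c' = begin
      nonAscents h 1 (interval 2 (suc k)) + (stepD + restD)
        ≡⟨ cong (_+ (stepD + restD)) (trans (cong (nonAscents h 1) (interval-∷ʳ 2 k)) (nonAscents-++ h 1 (interval 2 k) [ 2 + k ])) ⟩
      (restI + (⟦ h (2 + k) ≤ h (lastOf 1 (interval 2 k)) ⟧ + 0)) + (stepD + restD)
        ≡⟨ cong (λ z → (restI + (⟦ h (2 + k) ≤ h z ⟧ + 0)) + (stepD + restD)) (lastOf-interval 1 k) ⟩
      (restI + (stepI + 0)) + (stepD + restD)
        ≡⟨ regroup restI stepI stepD restD ⟩
      (restI + restD) + (stepI + stepD)
        ≡⟨ cong₂ _+_ (go k (<⇒≤ k<c')) (⟦≤⟧+⟦≥⟧≡1 (λ eq → adjacent-distinct k k<c' (sym eq))) ⟩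
      k + 1
        ≡⟨ +-comm k 1 ⟩
      suc k ∎
      where
      open ≡-Reasoning
      restI = nonAscents h 1 (interval 2 k)
      restD = nonAscents h (suc k) (countdown k)
      stepI = ⟦ h (2 + k) ≤ h (1 + k) ⟧
      stepD = ⟦ h (1 + k) ≤ h (2 + k) ⟧
      regroup : ∀ a x y b → (a + (x + 0)) + (y + b) ≡ (a + b) + (x + y)
      regroup = solve-∀

weighted-min-max-≤ : ∀ {a b} p q → a ≤ b → suc (p + q) * a + b ≤ a * suc p + b * suc q
weighted-min-max-≤ {a} {b} p q a≤b = begin
  suc (p + q) * a + b    ≡⟨ regroup a b p q ⟩
  a * suc p + b + q * a  ≤⟨ +-monoʳ-≤ (a * suc p + b) (*-monoʳ-≤ q a≤b) ⟩
  a * suc p + b + q * b  ≡⟨ regroup′ a b p q ⟩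
  a * suc p + b * suc q  ∎
  where
  open ≤-Reasoning
  regroup : ∀ a b p q → suc (p + q) * a + b ≡ a * suc p + b + q * a
  regroup = solve-∀
  regroup′ : ∀ a b p q → a * suc p + b + q * b ≡ a * suc p + b * suc q
  regroup′ = solve-∀

weighted-min-max : ∀ a b p q → suc (p + q) * (a ⊓ b) + (a ⊔ b) ≤ a * suc p + b * suc q
weighted-min-max a b p q with ≤-total a b
... | inj₁ a≤b = subst (_≤ a * suc p + b * suc q) (cong₂ (λ m M → suc (p + q) * m + M) (sym (m≤n⇒m⊓n≡m a≤b)) (sym (m≤n⇒m⊔n≡n a≤b)))
                   (weighted-min-max-≤ p q a≤b)
... | inj₂ b≤a = subst₂ _≤_
                   (trans (cong (λ k → suc k * b + a) (+-comm q p))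
                          (cong₂ (λ m M → suc (p + q) * m + M) (sym (m≥n⇒m⊓n≡n b≤a)) (sym (m≥n⇒m⊔n≡m b≤a))))
                    (+-comm (b * suc q) (a * suc p)) (weighted-min-max-≤ q p b≤a)

-- Whichever seam is 1, the opposite inside count is positive, so both weights given to
-- weighted-min-max are at least 1.
blockSum-≥ : ∀ {cT cF A B dI dD x y} → cF ≤ cT → x + y ≡ 1 → (dI ≡ 0 → x ≡ 1) → (dD ≡ 0 → y ≡ 1) →
  (dI + dD) * (A ⊓ B) + (A ⊔ B) + cF ≤ blockSum cT cF A B dI dD x y
blockSum-≥ {cT} {cF} {A} {B} {dI} {zero} {suc zero} {zero} _ _ _ dD≡0⇒y≡1 with dD≡0⇒y≡1 refl
... | ()
blockSum-≥ {cT} {cF} {A} {B} {dI} {suc q} {suc zero} {zero} _ _ _ _ = begin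
  (dI + suc q) * (A ⊓ B) + (A ⊔ B) + cF   ≡⟨ cong (λ k → k * (A ⊓ B) + (A ⊔ B) + cF) (+-suc dI q) ⟩
  suc (dI + q) * (A ⊓ B) + (A ⊔ B) + cF   ≤⟨ +-monoˡ-≤ cF (weighted-min-max A B dI q) ⟩
  A * suc dI + B * suc q + cF             ≡⟨ regroup cT cF A B dI q ⟩
  blockSum cT cF A B dI (suc q) 1 0       ∎
  where
  open ≤-Reasoning
  regroup : ∀ cT cF A B dI q → A * suc dI + B * suc q + cF ≡ cT * 0 + cF * 1 + A * (1 + dI) + B * (0 + suc q)
  regroup = solve-∀
blockSum-≥ {cT} {cF} {A} {B} {zero} {dD} {zero} {suc zero} _ _ dI≡0⇒x≡1 _ with dI≡0⇒x≡1 refl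
... | ()
blockSum-≥ {cT} {cF} {A} {B} {suc p} {dD} {zero} {suc zero} cF≤cT _ _ _ = begin
  suc (p + dD) * (A ⊓ B) + (A ⊔ B) + cF   ≤⟨ +-mono-≤ (weighted-min-max A B p dD) cF≤cT ⟩
  A * suc p + B * suc dD + cT             ≡⟨ regroup cT cF A B p dD ⟩
  blockSum cT cF A B (suc p) dD 0 1       ∎
  where
  open ≤-Reasoning
  regroup : ∀ cT cF A B p dD → A * suc p + B * suc dD + cT ≡ cT * 1 + cF * 0 + A * (0 + suc p) + B * (1 + dD)
  regroup = solve-∀

flipBelow : ℕ → ℕ → ℕ
flipBelow c a with suc a ≤? c
... | yes _ = c ∸ a
... | no _ = c

flipBelow-< : ∀ {c a} → a < c → flipBelow c a ≡ c ∸ a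
flipBelow-< {c} {a} a<c with suc a ≤? c
... | yes _ = refl
... | no a≮c = ⊥-elim (a≮c a<c)

flipBelow-≥ : ∀ {c a} → ¬ a < c → flipBelow c a ≡ c
flipBelow-≥ {c} {a} a≮c with suc a ≤? c
... | yes a<c = ⊥-elim (a≮c a<c)
... | no _ = refl

flipBelow-letter : ∀ c {a} → Letter c a → Letter c (flipBelow c a)
flipBelow-letter c {a} (1≤a , a≤c) with suc a ≤? c
... | yes a<c = m<n⇒0<n∸m a<c , m∸n≤m c a
... | no _ = ≤-trans 1≤a a≤c , ≤-refl

flipBelow-involutive : ∀ c {a} → Letter c a → flipBelow c (flipBelow c a) ≡ a
flipBelow-involutive c {a} (1≤a , a≤c) with suc a ≤? c
... | yes a<c = trans (flipBelow-< (∸-monoʳ-< 1≤a a≤c)) (m∸[m∸n]≡n a≤c)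
... | no a≮c = trans (flipBelow-≥ (n≮n c)) (≤-antisym (≮⇒≥ a≮c) a≤c)

map-flipBelow-countdown : ∀ {c} k → k < c → map (flipBelow c) (countdown k) ≡ interval (c ∸ k) k
map-flipBelow-countdown zero _ = refl
map-flipBelow-countdown {c} (suc k) k<c =
  cong₂ _∷_ (flipBelow-< k<c) (trans (map-flipBelow-countdown k (<⇒≤ k<c)) (cong (λ s → interval s k) (+-∸-assoc 1 (<⇒≤ k<c))))

∈-I⇒letter : ∀ {c a} → a ∈ I c → Letter c a
∈-I⇒letter a∈ with ∈-map⁻ suc a∈
... | i , i∈ , refl = s≤s z≤n , ∈-upTo⁻ i∈

letter⇒∈-I : ∀ {c a} → Letter c a → a ∈ I c
letter⇒∈-I {a = suc i} (_ , i<c) = ∈-map⁺ suc (∈-upTo⁺ i<c)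

altWord-letters : ∀ c b {n} (es : Vec ℕ n) → ListAll.All (Letter c) (altWord c b es)
altWord-letters c b [] = ListAll.[]
altWord-letters c true (e ∷ es) =
  ++⁺ (concat⁺ (replicate⁺ e (ListAll.tabulate ∈-I⇒letter))) (altWord-letters c false es)
altWord-letters c false (e ∷ es) =
  ++⁺ (concat⁺ (replicate⁺ e (ListAll.tabulate (∈-I⇒letter ∘ reverse⁻)))) (altWord-letters c true es)

letter⇒∈-uWord : ∀ {c a n} (e : Vec ℕ (suc n)) → All (λ x → 1 ≤ x) e → Letter c a → a ∈ uWord c e
letter⇒∈-uWord (suc _ ∷ _) (s≤s z≤n ∷ _) a-letter = ∈-++⁺ˡ (∈-++⁺ˡ (letter⇒∈-I a-letter))

nonAscents-map-uWord : ∀ {c' n} g (e : Vec ℕ (suc n)) → All (λ x → 1 ≤ x) e → g 1 ≤ suc c' →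
  nonAscents id (suc c') (map g (uWord (suc c') e)) ≡ nonAscents g 1 (uWord (suc c') e)
nonAscents-map-uWord {c'} g e@(suc _ ∷ _) (s≤s z≤n ∷ _) g1≤c = nonAscents-map-∷ g 1 (drop 1 (uWord (suc c') e)) g1≤c

contains-up-nonAscents-map : ∀ c g u → (∀ {a} → Letter c a → Letter c (g a)) → (∀ {a} → Letter c a → g (g a) ≡ a) →
  ListAll.All (Letter c) u → Contains (up c (nonAscents id c (map g u))) u
contains-up-nonAscents-map c g u g-letter g-involutive u-letters =
  involution⇒contains g (λ a∈ → g-involutive (ListAll.lookup u-letters a∈))
    (⊆-up-nonAscents c (map g u) (map⁺ (ListAll.map g-letter u-letters)))

InjectiveOnLetters : ℕ → (ℕ → ℕ) → Set
InjectiveOnLetters c h = ∀ {a b} → Letter c a → Letter c b → h a ≡ h b → a ≡ b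

injective⇒adjacent-distinct : ∀ {c'} h → InjectiveOnLetters (suc c') h → ∀ a → a < c' → h (suc a) ≢ h (suc (suc a))
injective⇒adjacent-distinct h h-inj a a<c' eq =
  <⇒≢ (n<1+n (suc a)) (h-inj (s≤s z≤n , <⇒≤ (s≤s a<c')) (s≤s z≤n , s≤s a<c') eq)

predictedL : ℕ → ∀ {n} → Vec ℕ n → ℕ
predictedL c {n} e = (c ∸ 1) * (sumOdd e ⊓ sumEven e) + (sumOdd e ⊔ sumEven e) + n / 2

module _ (c₀ : ℕ) {n : ℕ} (e : Vec ℕ (suc n)) (positive : All (λ x → 1 ≤ x) e) where

  private
    c = suc (suc c₀)
    u = uWord c e
    A = sumOdd e
    B = sumEven e

  predictedL-≤ : ∀ j → Contains (up c j) u → predictedL c e ≤ j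
  predictedL-≤ j contains with contains⇒injective-renaming contains
  ... | h , h-inj , map-h-u⊆up = begin
    suc c₀ * (A ⊓ B) + (A ⊔ B) + suc n / 2
      ≡⟨ cong₂ (λ c' k → c' * (A ⊓ B) + (A ⊔ B) + k) (sym insides) (sym (proj₁ (altCount≡half e))) ⟩
    (insideI + insideD) * (A ⊓ B) + (A ⊔ B) + altCount false e
      ≤⟨ blockSum-≥ (altCount-false≤true e) seams insideI≡0⇒seamI≡1 insideD≡0⇒seamD≡1 ⟩
    blockSum (altCount true e) (altCount false e) A B insideI insideD seamI seamD
      ≡⟨ sym (nonAscents-altWord seams true e positive) ⟩
    nonAscents h 1 u
      ≡⟨ sym (nonAscents-map h 1 u) ⟩
    nonAscents id (h 1) (map h u)
      ≤⟨ ⊆-up⇒nonAscents≤ c j (h 1) (map h u) map-h-u⊆up ⟩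
    j ∎
    where
    open ≤-Reasoning
    open BlockStatistics (suc c₀) h
    h-injective : InjectiveOnLetters c h
    h-injective a b = h-inj (letter⇒∈-uWord e positive a) (letter⇒∈-uWord e positive b)
    seams : seamI + seamD ≡ 1
    seams = seamI+seamD≡1 λ h1≡hc → 0≢1+n (suc-injective (h-injective (≤-refl , s≤s z≤n) (s≤s z≤n , ≤-refl) h1≡hc))
    insides : insideI + insideD ≡ suc c₀
    insides = insideI+insideD≡c' (injective⇒adjacent-distinct h h-injective)

  predictedL-contains-by : ∀ g → (∀ {a} → Letter c a → Letter c (g a)) → (∀ {a} → Letter c a → g (g a) ≡ a) →
    BlockStatistics.seamI (suc c₀) g ≡ 1 → BlockStatistics.seamD (suc c₀) g ≡ 0 →
    A * suc (BlockStatistics.insideI (suc c₀) g) + B * BlockStatistics.insideD (suc c₀) g + suc n / 2 ≤ predictedL c e →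
    Contains (up c (predictedL c e)) u
  predictedL-contains-by g g-letter g-involutive seamI≡1 seamD≡0 cost≤ =
    contains-up-mono nonAscents≤ (contains-up-nonAscents-map c g u g-letter g-involutive (altWord-letters c true e))
    where
    open BlockStatistics (suc c₀) g
    nonAscents≤ : nonAscents id c (map g u) ≤ predictedL c e
    nonAscents≤ = begin
      nonAscents id c (map g u)
        ≡⟨ nonAscents-map-uWord g e positive (proj₂ (g-letter (≤-refl , s≤s z≤n))) ⟩
      nonAscents g 1 u
        ≡⟨ nonAscents-altWord (cong₂ _+_ seamI≡1 seamD≡0) true e positive ⟩
      blockSum (altCount true e) (altCount false e) A B insideI insideD seamI seamD
        ≡⟨ cong₂ (blockSum (altCount true e) (altCount false e) A B insideI insideD) seamI≡1 seamD≡0 ⟩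
      blockSum (altCount true e) (altCount false e) A B insideI insideD 1 0
        ≡⟨ regroup (altCount true e) (altCount false e) A B insideI insideD ⟩
      A * suc insideI + B * insideD + altCount false e
        ≡⟨ cong (A * suc insideI + B * insideD +_) (proj₁ (altCount≡half e)) ⟩
      A * suc insideI + B * insideD + suc n / 2
        ≤⟨ cost≤ ⟩
      predictedL c e ∎
      where
      open ≤-Reasoning
      regroup : ∀ cT cF A B dI dD → cT * 0 + cF * 1 + A * (1 + dI) + B * (0 + dD) ≡ A * suc dI + B * dD + cF
      regroup = solve-∀

  predictedL-contains-by-id : B ≤ A → Contains (up c (predictedL c e)) u
  predictedL-contains-by-id B≤A =
    predictedL-contains-by id (λ a-letter → a-letter) (λ _ → refl) (⟦≤⟧≡1 {1} {c} (s≤s z≤n)) (⟦≤⟧≡0 {c} {1} λ { (s≤s ()) }) (≤-reflexive cost≡)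
    where
    open BlockStatistics (suc c₀) id
    insideI≡0 : insideI ≡ 0
    insideI≡0 = nonAscents-interval≡0 1 (suc c₀)
    insideD≡c' : insideD ≡ suc c₀
    insideD≡c' = trans (sym (cong (_+ insideD) insideI≡0))
                       (insideI+insideD≡c' (injective⇒adjacent-distinct id λ _ _ eq → eq))
    cost≡ : A * suc insideI + B * insideD + suc n / 2 ≡ predictedL c e
    cost≡ = begin
      A * suc insideI + B * insideD + suc n / 2   ≡⟨ cong₂ (λ i d → A * suc i + B * d + suc n / 2) insideI≡0 insideD≡c' ⟩
      A * 1 + B * suc c₀ + suc n / 2              ≡⟨ regroup A B c₀ (suc n / 2) ⟩
      suc c₀ * B + A + suc n / 2                  ≡⟨ cong₂ (λ m M → suc c₀ * m + M + suc n / 2) (sym (m≥n⇒m⊓n≡n B≤A)) (sym (m≥n⇒m⊔n≡m B≤A)) ⟩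
      predictedL c e                              ∎
      where
      open ≡-Reasoning
      regroup : ∀ A B c₀ k → A * 1 + B * suc c₀ + k ≡ suc c₀ * B + A + k
      regroup = solve-∀

  predictedL-contains-by-flipBelow : A ≤ B → Contains (up c (predictedL c e)) u
  predictedL-contains-by-flipBelow A≤B =
    predictedL-contains-by g (flipBelow-letter c) (flipBelow-involutive c) seamI≡1 seamD≡0 (≤-reflexive cost≡)
    where
    g = flipBelow c
    open BlockStatistics (suc c₀) g
    g1≡c' : g 1 ≡ suc c₀
    g1≡c' = flipBelow-< (s≤s (s≤s z≤n))
    gc≡c : g c ≡ c
    gc≡c = flipBelow-≥ (n≮n c)
    seamI≡1 : seamI ≡ 1
    seamI≡1 = ⟦≤⟧≡1 (subst₂ _≤_ (sym g1≡c') (sym gc≡c) (n≤1+n (suc c₀)))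
    seamD≡0 : seamD ≡ 0
    seamD≡0 = ⟦≤⟧≡0 λ gc≤g1 → 1+n≰n (subst₂ _≤_ gc≡c g1≡c' gc≤g1)
    insideD≡1 : insideD ≡ 1
    insideD≡1 = begin
      nonAscents g c (countdown (suc c₀))                 ≡⟨ sym (nonAscents-map g c (countdown (suc c₀))) ⟩
      nonAscents id (g c) (map g (countdown (suc c₀)))    ≡⟨ cong₂ (nonAscents id) gc≡c (map-flipBelow-countdown (suc c₀) ≤-refl) ⟩
      nonAscents id c (interval (suc c₀ ∸ c₀) (suc c₀))   ≡⟨ cong (λ s → nonAscents id c (interval s (suc c₀))) (m+n∸n≡m 1 c₀) ⟩
      ⟦ 1 ≤ c ⟧ + nonAscents id 1 (interval 2 c₀)         ≡⟨ cong₂ _+_ (⟦≤⟧≡1 {1} {c} (s≤s z≤n)) (nonAscents-interval≡0 1 c₀) ⟩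
      1                                                   ∎
      where open ≡-Reasoning
    insideI≡c₀ : insideI ≡ c₀
    insideI≡c₀ = +-cancelʳ-≡ 1 insideI c₀ (trans (cong (insideI +_) (sym insideD≡1))
      (trans (insideI+insideD≡c' (injective⇒adjacent-distinct g g-injective)) (+-comm 1 c₀)))
      where
      g-injective : InjectiveOnLetters c g
      g-injective a-letter b-letter ga≡gb =
        trans (sym (flipBelow-involutive c a-letter)) (trans (cong g ga≡gb) (flipBelow-involutive c b-letter))
    cost≡ : A * suc insideI + B * insideD + suc n / 2 ≡ predictedL c e
    cost≡ = begin
      A * suc insideI + B * insideD + suc n / 2   ≡⟨ cong₂ (λ i d → A * suc i + B * d + suc n / 2) insideI≡c₀ insideD≡1 ⟩
      A * suc c₀ + B * 1 + suc n / 2              ≡⟨ regroup A B c₀ (suc n / 2) ⟩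
      suc c₀ * A + B + suc n / 2                  ≡⟨ cong₂ (λ m M → suc c₀ * m + M + suc n / 2) (sym (m≤n⇒m⊓n≡m A≤B)) (sym (m≤n⇒m⊔n≡n A≤B)) ⟩
      predictedL c e                              ∎
      where
      open ≡-Reasoning
      regroup : ∀ A B c₀ k → A * suc c₀ + B * 1 + k ≡ suc c₀ * A + B + k
      regroup = solve-∀

theorem3p4 : (c n : ℕ) → 2 ≤ c → 1 ≤ n → (e : Vec ℕ n) → All (λ x → 1 ≤ x) e →
    IsL c (uWord c e) ((c ∸ 1) * (sumOdd e ⊓ sumEven e) + (sumOdd e ⊔ sumEven e) + n / 2)
theorem3p4 (suc (suc c₀)) (suc n) (s≤s (s≤s z≤n)) (s≤s z≤n) e positive with ≤-total (sumEven e) (sumOdd e)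
... | inj₁ B≤A = predictedL-contains-by-id c₀ e positive B≤A , predictedL-≤ c₀ e positive
... | inj₂ A≤B = predictedL-contains-by-flipBelow c₀ e positive A≤B , predictedL-≤ c₀ e positive
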